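{- For every graph $G$ and every integer $k\ge 2$, $$\gamma_{k{\rm rt}}(G)\ge \frac{2k}{k+1}\gamma(G).$$
   Context: All graphs are finite, simple and undirected; $N(v)$ denotes the open neighborhood of $v$, and $[k]=\{1,\dots,k\}$. $\gamma(G)$ is the domination number. A $k$-rainbow total dominating function ($k$RTDF) of $G$ is a function $f:V(G)\to 2^{[k]}$ such that (i) every vertex $v$ with $f(v)=\emptyset$ satisfies $\bigcup_{u\in N(v)}f(u)=[k]$, and (ii) for every vertex $v$ with $f(v)=\{i\}$ for some $i\in[k]$ there is $u\in N(v)$ with $i\in f(u)$. Its weight is $\|f\|=\sum_{v}|f(v)|$ and $\gamma_{k{\rm rt}}(G)$ is the minimum weight of a $k$RTDF of $G$. -}

module Defs where

open import Data.Nat using (ℕ; _≤_; _+_; _*_)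
open import Data.Bool using (Bool; T; false)
open import Data.Fin using (Fin)
open import Data.Fin.Subset using (Subset; _∈_; ⊥; ⁅_⁆; ∣_∣)
open import Data.List using (map; allFin)
open import Data.Nat.ListAction using (sum)
open import Data.Product using (Σ; ∃; _×_)
open import Data.Sum using (_⊎_)
open import Relation.Binary.PropositionalEquality using (_≡_)

record Graph : Set where
  field
    n     : ℕ
    adj   : Fin n → Fin n → Bool
    sym   : ∀ u v → adj u v ≡ adj v u
    irrefl : ∀ v → adj v v ≡ false

open Graph public

Adj : (G : Graph) → Fin (n G) → Fin (n G) → Set
Adj G u v = T (adj G u v)

IsDominatingSet : (G : Graph) → Subset (n G) → Set
IsDominatingSet G D = ∀ v → v ∈ D ⊎ ∃ λ u → Adj G u v × u ∈ D

IsDominationNumber : (G : Graph) → ℕ → Set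
IsDominationNumber G g =
  (Σ (Subset (n G)) λ D → IsDominatingSet G D × ∣ D ∣ ≡ g)
  × (∀ D → IsDominatingSet G D → g ≤ ∣ D ∣)

IsKRTDF : (G : Graph) (k : ℕ) → (Fin (n G) → Subset k) → Set
IsKRTDF G k f =
  (∀ v → f v ≡ ⊥ → ∀ (i : Fin k) → ∃ λ u → Adj G u v × i ∈ f u)
  × (∀ v (i : Fin k) → f v ≡ ⁅ i ⁆ → ∃ λ u → Adj G u v × i ∈ f u)

weight : (G : Graph) {k : ℕ} → (Fin (n G) → Subset k) → ℕ
weight G f = sum (map (λ v → ∣ f v ∣) (allFin (n G)))

IsKRTDNumber : (G : Graph) (k : ℕ) → ℕ → Set
IsKRTDNumber G k r =
  (Σ (Fin (n G) → Subset k) λ f → IsKRTDF G k f × weight G f ≡ r)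
  × (∀ f → IsKRTDF G k f → r ≤ weight G f)

-- Let f be a kRTDF of minimum weight r = γ_krt(G), write c(v) = |f(v)| and
-- split the vertices into H = {c ≥ 2} and W = {c = 1}.  By a relative form of
-- Ore's theorem there is S ⊆ W with 2|S| ≤ |W| dominating every vertex of W
-- that has a neighbour in W.  For each colour i the set
--     D_i = H ∪ S ∪ {v : i ∈ f(v)}
-- is dominating, so kγ ≤ Σ_i |D_i|.  Counting Σ_i |D_i| vertex by vertex, a
-- vertex contributes k if it lies in H ∪ S and c(v) otherwise; a per-vertex
-- inequality (the "charge" lemma) and 2|S| ≤ |W| give 2 Σ_i |D_i| ≤ (k+1) r.

module Submission where

open import Defs hiding (sym)
open import Data.Nat hiding (_≟_)
open import Data.Nat.Properties hiding (_≟_)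
open import Data.Nat.Induction using (<-wellFounded)
open import Data.Nat.Tactic.RingSolver using (solve-∀)
import Data.Nat.ListAction as List
open import Data.Bool using (Bool; true; false; T; _∨_; if_then_else_)
open import Data.Fin using (Fin; zero; suc; _≟_)
open import Data.Fin.Properties using (any?; all?; ¬∀⟶∃¬)
open import Data.Fin.Subset
  using (Subset; _∈_; _∉_; _⊆_; ⊥; ⁅_⁆; ∣_∣; _∪_; _─_; _-_)
open import Data.Fin.Subset.Properties
  using (_∈?_; ∉⊥; drop-∷-⊆; p─q⊆p; x∈p∪q⁺; x∈p∧x∉q⇒x∈p─q;
         x∈p∧x≢y⇒x∈p-y; x∈p⇒∣p-x∣<∣p∣)
import Data.List as L
open import Data.List.Properties using (map-tabulate)
open import Data.Vec using (_∷_; []; lookup; tabulate; here)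
open import Data.Vec.Properties
  using (lookup∘tabulate; lookup-zipWith; []=⇒lookup; lookup⇒[]=)
open import Data.Product using (∃; _×_; _,_; proj₁; proj₂)
open import Data.Sum using (_⊎_; inj₁; inj₂)
open import Data.Empty using (⊥-elim)
open import Data.Unit using (tt)
open import Function using (_∘_; id)
open import Induction.WellFounded using (Acc; acc)
open import Relation.Nullary using (Dec; yes; no; ¬_; contradiction)
open import Relation.Nullary.Decidable using (_×-dec_; _⊎-dec_; _→-dec_; T?)
open import Relation.Binary.PropositionalEquality
open import Algebra.Properties.Semiring.Sum +-*-semiring
  using (sum; sum-syntax; sum-cong-≗; ∑-distrib-+; ∑-comm; *-distribˡ-sum)

∑-const : ∀ n x → ∑[ i < n ] x ≡ n * x
∑-const zero    x = refl
∑-const (suc n) x = cong (x +_) (∑-const n x)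

∑-mono-≤ : ∀ {n} {f g : Fin n → ℕ} → (∀ i → f i ≤ g i) → sum f ≤ sum g
∑-mono-≤ {zero}  f≤g = z≤n
∑-mono-≤ {suc n} f≤g = +-mono-≤ (f≤g zero) (∑-mono-≤ (f≤g ∘ suc))

∑-linear : ∀ {n} x y (f g : Fin n → ℕ) →
           ∑[ i < n ] (x * f i + y * g i) ≡ x * sum f + y * sum g
∑-linear {n} x y f g = begin
  ∑[ i < n ] (x * f i + y * g i)            ≡⟨ ∑-distrib-+ (λ i → x * f i) (λ i → y * g i) ⟩
  sum (λ i → x * f i) + sum (λ i → y * g i) ≡⟨ sym (cong₂ _+_ (*-distribˡ-sum x f) (*-distribˡ-sum y g)) ⟩
  x * sum f + y * sum g                     ∎
  where open ≡-Reasoning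

weight≡∑ : ∀ (G : Graph) {k} (f : Fin (n G) → Subset k) →
           weight G f ≡ ∑[ v < n G ] ∣ f v ∣
weight≡∑ G f = trans (cong List.sum (map-tabulate id (λ v → ∣ f v ∣)))
                     (listSum-tabulate (λ v → ∣ f v ∣))
  where
  listSum-tabulate : ∀ {m} (h : Fin m → ℕ) → List.sum (L.tabulate h) ≡ sum h
  listSum-tabulate {zero}  h = refl
  listSum-tabulate {suc m} h = cong (h zero +_) (listSum-tabulate (h ∘ suc))

twiceMin : ∀ a b → 2 * a ≤ a + b ⊎ 2 * b ≤ a + b
twiceMin a b with ≤-total a b
... | inj₁ a≤b = inj₁ (subst (_≤ a + b) (sym (cong (a +_) (+-identityʳ a))) (+-monoʳ-≤ a a≤b))
... | inj₂ b≤a = inj₂ (subst (_≤ a + b) (sym (cong (b +_) (+-identityʳ b))) (+-monoˡ-≤ b b≤a))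

𝟙 : Bool → ℕ
𝟙 true  = 1
𝟙 false = 0

∣p∣≡∑ : ∀ {n} (p : Subset n) → ∣ p ∣ ≡ ∑[ i < n ] 𝟙 (lookup p i)
∣p∣≡∑ []          = refl
∣p∣≡∑ (true ∷ p)  = cong suc (∣p∣≡∑ p)
∣p∣≡∑ (false ∷ p) = ∣p∣≡∑ p

∑𝟙-∨ : ∀ {k} b (p : Subset k) →
       ∑[ i < k ] 𝟙 (b ∨ lookup p i) ≡ (if b then k else ∣ p ∣)
∑𝟙-∨ {k} true  p = trans (∑-const k 1) (*-identityʳ k)
∑𝟙-∨     false p = sym (∣p∣≡∑ p)

∣p∣+∣q─p∣≡∣q∣ : ∀ {n} (p q : Subset n) → p ⊆ q → ∣ p ∣ + ∣ q ─ p ∣ ≡ ∣ q ∣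
∣p∣+∣q─p∣≡∣q∣ []          []          p⊆q = refl
∣p∣+∣q─p∣≡∣q∣ (true ∷ p)  (true ∷ q)  p⊆q = cong suc (∣p∣+∣q─p∣≡∣q∣ p q (drop-∷-⊆ p⊆q))
∣p∣+∣q─p∣≡∣q∣ (true ∷ p)  (false ∷ q) p⊆q = contradiction (p⊆q here) λ ()
∣p∣+∣q─p∣≡∣q∣ (false ∷ p) (true ∷ q)  p⊆q =
  trans (+-suc ∣ p ∣ ∣ q ─ p ∣) (cong suc (∣p∣+∣q─p∣≡∣q∣ p q (drop-∷-⊆ p⊆q)))
∣p∣+∣q─p∣≡∣q∣ (false ∷ p) (false ∷ q) p⊆q = ∣p∣+∣q─p∣≡∣q∣ p q (drop-∷-⊆ p⊆q)

∣p∣≡0⇒p≡⊥ : ∀ {n} (p : Subset n) → ∣ p ∣ ≡ 0 → p ≡ ⊥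
∣p∣≡0⇒p≡⊥ []          _     = refl
∣p∣≡0⇒p≡⊥ (true ∷ p)  ()
∣p∣≡0⇒p≡⊥ (false ∷ p) ∣p∣≡0 = cong (false ∷_) (∣p∣≡0⇒p≡⊥ p ∣p∣≡0)

∣p∣≡1⇒⁅⁆ : ∀ {n} (p : Subset n) → ∣ p ∣ ≡ 1 → ∃ λ j → p ≡ ⁅ j ⁆
∣p∣≡1⇒⁅⁆ (true ∷ p)  ∣p∣≡1 = zero , cong (true ∷_) (∣p∣≡0⇒p≡⊥ p (suc-injective ∣p∣≡1))
∣p∣≡1⇒⁅⁆ (false ∷ p) ∣p∣≡1 with ∣p∣≡1⇒⁅⁆ p ∣p∣≡1
... | j , refl = suc j , refl

∈-tabulate : ∀ {n} (P : Fin n → Bool) {v} → P v ≡ true → v ∈ tabulate P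
∈-tabulate P {v} Pv = lookup⇒[]= v (tabulate P) (trans (lookup∘tabulate P v) Pv)

-- For W ⊆ V(G) there is S ⊆ W with 2|S| ≤ |W| that dominates every vertex
-- of W having a neighbour in W (Ore: a graph without isolated vertices has
-- a dominating set of at most half its order; here applied to G[W]).

module Ore (G : Graph) where

  VSet : Set
  VSet = Subset (n G)

  adj-sym : ∀ {u v} → Adj G u v → Adj G v u
  adj-sym {u} {v} = subst T (Graph.sym G u v)

  adj-irrefl : ∀ {v} → ¬ Adj G v v
  adj-irrefl {v} a with adj G v v | Graph.irrefl G v
  adj-irrefl () | false | refl

  NbrIn : VSet → Fin (n G) → Set
  NbrIn X v = ∃ λ u → Adj G u v × u ∈ X

  nbrIn? : ∀ X v → Dec (NbrIn X v)
  nbrIn? X v = any? λ u → T? (adj G u v) ×-dec (u ∈? X)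

  DominatedAt : VSet → VSet → Fin (n G) → Set
  DominatedAt W S v = v ∈ W → NbrIn W v → v ∈ S ⊎ NbrIn S v

  dominatedAt? : ∀ W S v → Dec (DominatedAt W S v)
  dominatedAt? W S v = (v ∈? W) →-dec (nbrIn? W v →-dec ((v ∈? S) ⊎-dec nbrIn? S v))

  DominatesWithin : VSet → VSet → Set
  DominatesWithin W S = ∀ v → DominatedAt W S v

  dominatesWithin? : ∀ W S → Dec (DominatesWithin W S)
  dominatesWithin? W S = all? (dominatedAt? W S)

  Minimal : VSet → VSet → Set
  Minimal W R = ∀ v → v ∈ R → ¬ DominatesWithin W (R - v)

  undominated : ∀ W S → ¬ DominatesWithin W S →
                ∃ λ x → x ∈ W × NbrIn W x × x ∉ S × ¬ NbrIn S x
  undominated W S ¬dom with ¬∀⟶∃¬ (n G) (DominatedAt W S) (dominatedAt? W S) ¬dom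
  ... | x , ¬ok with x ∈? W | nbrIn? W x
  ... | no x∉W  | _        = ⊥-elim (¬ok λ x∈W → contradiction x∈W x∉W)
  ... | yes _   | no ¬nb   = ⊥-elim (¬ok λ _ nb → contradiction nb ¬nb)
  ... | yes x∈W | yes nb   =
    x , x∈W , nb , (λ x∈S → ¬ok λ _ _ → inj₁ x∈S) , (λ nbS → ¬ok λ _ _ → inj₂ nbS)

  minimalSubset : ∀ W S → Acc _<_ ∣ S ∣ → DominatesWithin W S →
                  ∃ λ R → R ⊆ S × DominatesWithin W R × Minimal W R
  minimalSubset W S (acc smaller) dom
    with any? (λ v → (v ∈? S) ×-dec dominatesWithin? W (S - v))
  ... | no none = S , id , dom , λ v v∈S dom-v → none (v , v∈S , dom-v)
  ... | yes (v , v∈S , dom-v)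
    with minimalSubset W (S - v) (smaller (x∈p⇒∣p-x∣<∣p∣ v∈S)) dom-v
  ... | R , R⊆S-v , domR , minR = R , p─q⊆p S ⁅ v ⁆ ∘ R⊆S-v , domR , minR

  complementDominates : ∀ W R → DominatesWithin W R → Minimal W R →
                        DominatesWithin W (W ─ R)
  complementDominates W R domR minR v v∈W (u , u~v , u∈W) with v ∈? R
  ... | no v∉R = inj₁ (x∈p∧x∉q⇒x∈p─q v∈W v∉R)
  ... | yes v∈R with undominated W (R - v) (minR v v∈R)
  ... | x , x∈W , nbx , x∉R-v , ¬nbR-v with x ≟ v
  ...   | yes refl = inj₂ (u , u~v , x∈p∧x∉q⇒x∈p─q u∈W u∉R)
    where
    u∉R : u ∉ R
    u∉R u∈R = ¬nbR-v (u , u~v , x∈p∧x≢y⇒x∈p-y u∈R λ { refl → adj-irrefl u~v })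
  ...   | no x≢v with domR x x∈W nbx
  ...     | inj₁ x∈R = contradiction (x∈p∧x≢y⇒x∈p-y x∈R x≢v) x∉R-v
  ...     | inj₂ (y , y~x , y∈R) with y ≟ v
  ...       | no y≢v = contradiction (y , y~x , x∈p∧x≢y⇒x∈p-y y∈R y≢v) ¬nbR-v
  ...       | yes refl = inj₂ (x , adj-sym y~x , x∈p∧x∉q⇒x∈p─q x∈W x∉R)
    where
    x∉R : x ∉ R
    x∉R x∈R = x∉R-v (x∈p∧x≢y⇒x∈p-y x∈R x≢v)

  record OreSet (W : VSet) : Set where
    field
      S           : VSet
      S⊆W         : S ⊆ W
      S-small     : 2 * ∣ S ∣ ≤ ∣ W ∣
      S-dominates : DominatesWithin W S

  -- Of a minimal R ⊆ W and W ─ R, both dominating, the smaller one works.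
  ore : ∀ W → OreSet W
  ore W with minimalSubset W W (<-wellFounded ∣ W ∣) (λ v _ nb → inj₂ nb)
  ... | R , R⊆W , domR , minR with twiceMin ∣ R ∣ ∣ W ─ R ∣
  ...   | inj₁ small = record
    { S = R ; S⊆W = R⊆W ; S-dominates = domR
    ; S-small = subst (2 * ∣ R ∣ ≤_) (∣p∣+∣q─p∣≡∣q∣ R W R⊆W) small }
  ...   | inj₂ small = record
    { S = W ─ R ; S⊆W = p─q⊆p W R ; S-dominates = complementDominates W R domR minR
    ; S-small = subst (2 * ∣ W ─ R ∣ ≤_) (∣p∣+∣q─p∣≡∣q∣ R W R⊆W) small }

-- A vertex of weight c, lying in S exactly when s holds (only possible if
-- c = 1), is counted in Σ_i |D_i| once per colour if it is heavy or in S,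
-- and c times otherwise.

charge : ∀ m c s → (s ≡ true → c ≡ 1) →
         2 * (if (2 ≤ᵇ c) ∨ s then suc m else c) + m * 𝟙 (c ≡ᵇ 1)
           ≤ (suc m + 1) * c + 2 * m * 𝟙 s
charge m zero          false _   = ≤-reflexive (weightless m)
  where weightless : ∀ m → 2 * 0 + m * 0 ≡ (suc m + 1) * 0 + 2 * m * 0
        weightless = solve-∀
charge m (suc zero)    false _   = ≤-reflexive (single m)
  where single : ∀ m → 2 * 1 + m * 1 ≡ (suc m + 1) * 1 + 2 * m * 0
        single = solve-∀
charge m (suc zero)    true  _   = ≤-reflexive (singleInS m)
  where singleInS : ∀ m → 2 * suc m + m * 1 ≡ (suc m + 1) * 1 + 2 * m * 1
        singleInS = solve-∀
charge m (suc (suc t)) false _   =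
  subst₂ _≤_ (sym (heavyLeft m)) (sym (heavyRight m t))
         (*-mono-≤ (m≤m+n (suc m) 1) (s≤s (s≤s z≤n)))
  where heavyLeft : ∀ m → 2 * suc m + m * 0 ≡ suc m * 2
        heavyLeft = solve-∀
        heavyRight : ∀ m t → (suc m + 1) * (2 + t) + 2 * m * 0 ≡ (suc m + 1) * (2 + t)
        heavyRight = solve-∀
charge m zero          true  s⇒1 = contradiction (s⇒1 refl) λ ()
charge m (suc (suc t)) true  s⇒1 = contradiction (s⇒1 refl) λ ()

module RainbowFamily (G : Graph) (m : ℕ) (f : Fin (n G) → Subset (suc m))
                     (isKRTDF : IsKRTDF G (suc m) f) where

  open Ore G

  k : ℕ
  k = suc m

  c : Fin (n G) → ℕ
  c v = ∣ f v ∣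

  H : VSet
  H = tabulate λ v → 2 ≤ᵇ c v

  W : VSet
  W = tabulate λ v → c v ≡ᵇ 1

  F : Fin k → VSet
  F i = tabulate λ v → lookup (f v) i

  -- Ore's set S for W.
  opaque
    oreSet : OreSet W
    oreSet = ore W

  open OreSet oreSet

  D : Fin k → VSet
  D i = (H ∪ S) ∪ F i

  H⊆D : ∀ i {v} → v ∈ H → v ∈ D i
  H⊆D i v∈H = x∈p∪q⁺ (inj₁ (x∈p∪q⁺ (inj₁ v∈H)))

  S⊆D : ∀ i {v} → v ∈ S → v ∈ D i
  S⊆D i v∈S = x∈p∪q⁺ (inj₁ (x∈p∪q⁺ (inj₂ v∈S)))

  F⊆D : ∀ i {v} → v ∈ F i → v ∈ D i
  F⊆D i v∈F = x∈p∪q⁺ (inj₂ v∈F)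

  heavy : ∀ {v t} → c v ≡ suc (suc t) → v ∈ H
  heavy cv = ∈-tabulate (λ v → 2 ≤ᵇ c v) (cong (2 ≤ᵇ_) cv)

  light : ∀ {v} → c v ≡ 1 → v ∈ W
  light cv = ∈-tabulate (λ v → c v ≡ᵇ 1) (cong (_≡ᵇ 1) cv)

  coloured : ∀ {i v} → i ∈ f v → v ∈ F i
  coloured {i} i∈fv = ∈-tabulate (λ v → lookup (f v) i) ([]=⇒lookup i∈fv)

  -- A vertex of weight 1 is dominated by each D i: its colour j is seen by a
  -- neighbour u, which is heavy or of weight 1; in the latter case S
  -- dominates v within W.
  lightDominated : ∀ i v → c v ≡ 1 → v ∈ D i ⊎ ∃ λ u → Adj G u v × u ∈ D i
  lightDominated i v cv with ∣p∣≡1⇒⁅⁆ (f v) cv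
  ... | j , fv≡⁅j⁆ with proj₂ isKRTDF v j fv≡⁅j⁆
  ... | u , u~v , j∈fu with c u in cu
  ... | zero        = contradiction (subst (j ∈_) (∣p∣≡0⇒p≡⊥ (f u) cu) j∈fu) ∉⊥
  ... | suc (suc t) = inj₂ (u , u~v , H⊆D i (heavy cu))
  ... | suc zero with S-dominates v (light cv) (u , u~v , light cu)
  ...   | inj₁ v∈S             = inj₁ (S⊆D i v∈S)
  ...   | inj₂ (w , w~v , w∈S) = inj₂ (w , w~v , S⊆D i w∈S)

  -- Each D i is dominating: empty vertices see colour i, heavy vertices lie
  -- in H, and vertices of weight 1 are handled above.
  D-dominating : ∀ i → IsDominatingSet G (D i)
  D-dominating i v with c v in cv
  ... | zero with proj₁ isKRTDF v (∣p∣≡0⇒p≡⊥ (f v) cv) i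
  ...   | u , u~v , i∈fu = inj₂ (u , u~v , F⊆D i (coloured i∈fu))
  D-dominating i v | suc zero    = lightDominated i v cv
  D-dominating i v | suc (suc t) = inj₁ (H⊆D i (heavy cv))

  inHS : Fin (n G) → Bool
  inHS v = (2 ≤ᵇ c v) ∨ lookup S v

  lookup-D : ∀ i v → lookup (D i) v ≡ inHS v ∨ lookup (f v) i
  lookup-D i v = begin
    lookup ((H ∪ S) ∪ F i) v                     ≡⟨ lookup-zipWith _∨_ v (H ∪ S) (F i) ⟩
    lookup (H ∪ S) v ∨ lookup (F i) v            ≡⟨ cong₂ _∨_ (lookup-zipWith _∨_ v H S)
                                                              (lookup∘tabulate (λ u → lookup (f u) i) v) ⟩
    (lookup H v ∨ lookup S v) ∨ lookup (f v) i   ≡⟨ cong (λ b → (b ∨ lookup S v) ∨ lookup (f v) i)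
                                                         (lookup∘tabulate (λ u → 2 ≤ᵇ c u) v) ⟩
    inHS v ∨ lookup (f v) i                      ∎
    where open ≡-Reasoning

  multiplicity : Fin (n G) → ℕ
  multiplicity v = if inHS v then k else c v

  ∑𝟙-D : ∀ v → ∑[ i < k ] 𝟙 (lookup (D i) v) ≡ multiplicity v
  ∑𝟙-D v = trans (sum-cong-≗ (λ i → cong 𝟙 (lookup-D i v))) (∑𝟙-∨ (inHS v) (f v))

  ∑∣D∣≡∑multiplicity : ∑[ i < k ] ∣ D i ∣ ≡ ∑[ v < n G ] multiplicity v
  ∑∣D∣≡∑multiplicity = begin
    ∑[ i < k ] ∣ D i ∣                              ≡⟨ sum-cong-≗ (λ i → ∣p∣≡∑ (D i)) ⟩
    ∑[ i < k ] ∑[ v < n G ] 𝟙 (lookup (D i) v)     ≡⟨ ∑-comm (λ i v → 𝟙 (lookup (D i) v)) ⟩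
    ∑[ v < n G ] ∑[ i < k ] 𝟙 (lookup (D i) v)     ≡⟨ sum-cong-≗ ∑𝟙-D ⟩
    ∑[ v < n G ] multiplicity v                     ∎
    where open ≡-Reasoning

  inS⇒light : ∀ v → lookup S v ≡ true → c v ≡ 1
  inS⇒light v v∈S = ≡ᵇ⇒≡ (c v) 1 (subst T (sym c≡ᵇ1) tt)
    where
    c≡ᵇ1 : (c v ≡ᵇ 1) ≡ true
    c≡ᵇ1 = trans (sym (lookup∘tabulate (λ u → c u ≡ᵇ 1) v))
                 ([]=⇒lookup (S⊆W (lookup⇒[]= v S v∈S)))

  vertexCharge : ∀ v → 2 * multiplicity v + m * 𝟙 (lookup W v)
                         ≤ (k + 1) * c v + 2 * m * 𝟙 (lookup S v)
  vertexCharge v rewrite lookup∘tabulate (λ u → c u ≡ᵇ 1) v =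
    charge m (c v) (lookup S v) (inS⇒light v)

  countingBound : 2 * ∑[ i < k ] ∣ D i ∣ ≤ (k + 1) * weight G f
  countingBound = +-cancelʳ-≤ (m * ∣ W ∣) _ _ (begin
    2 * ∑[ i < k ] ∣ D i ∣ + m * ∣ W ∣
      ≡⟨ cong₂ (λ a b → 2 * a + m * b) ∑∣D∣≡∑multiplicity (∣p∣≡∑ W) ⟩
    2 * sum multiplicity + m * ∑[ v < n G ] 𝟙 (lookup W v)
      ≡⟨ sym (∑-linear 2 m multiplicity (λ v → 𝟙 (lookup W v))) ⟩
    ∑[ v < n G ] (2 * multiplicity v + m * 𝟙 (lookup W v))
      ≤⟨ ∑-mono-≤ vertexCharge ⟩
    ∑[ v < n G ] ((k + 1) * c v + 2 * m * 𝟙 (lookup S v))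
      ≡⟨ ∑-linear (k + 1) (2 * m) c (λ v → 𝟙 (lookup S v)) ⟩
    (k + 1) * sum c + 2 * m * ∑[ v < n G ] 𝟙 (lookup S v)
      ≡⟨ cong₂ (λ a b → (k + 1) * a + 2 * m * b) (sym (weight≡∑ G f)) (sym (∣p∣≡∑ S)) ⟩
    (k + 1) * weight G f + 2 * m * ∣ S ∣
      ≤⟨ +-monoʳ-≤ ((k + 1) * weight G f) halfOfW ⟩
    (k + 1) * weight G f + m * ∣ W ∣ ∎)
    where
    open ≤-Reasoning
    halfOfW : 2 * m * ∣ S ∣ ≤ m * ∣ W ∣
    halfOfW = begin
      2 * m * ∣ S ∣   ≡⟨ cong (_* ∣ S ∣) (*-comm 2 m) ⟩
      m * 2 * ∣ S ∣   ≡⟨ *-assoc m 2 ∣ S ∣ ⟩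
      m * (2 * ∣ S ∣) ≤⟨ *-monoʳ-≤ m S-small ⟩
      m * ∣ W ∣       ∎

-- Each D i has at least γ vertices, so 2kγ ≤ 2 Σ_i |D i| ≤ (k+1) γ_krt
-- (the argument only needs k ≥ 1).
theorem10 : (G : Graph) (k : ℕ) → 2 ≤ k → (g r : ℕ) →
    IsDominationNumber G g → IsKRTDNumber G k r →
    2 * k * g ≤ (k + 1) * r
theorem10 G zero () _ _ _ _
theorem10 G (suc m) _ g r (_ , γ-minimal) ((f , isKRTDF , weight≡r) , _) = begin
  2 * suc m * g               ≡⟨ *-assoc 2 (suc m) g ⟩
  2 * (suc m * g)             ≡⟨ cong (2 *_) (sym (∑-const (suc m) g)) ⟩
  2 * ∑[ i < suc m ] g        ≤⟨ *-monoʳ-≤ 2 (∑-mono-≤ λ i → γ-minimal (D i) (D-dominating i)) ⟩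
  2 * ∑[ i < suc m ] ∣ D i ∣  ≤⟨ countingBound ⟩
  (suc m + 1) * weight G f    ≡⟨ cong ((suc m + 1) *_) weight≡r ⟩
  (suc m + 1) * r             ∎
  where
  open RainbowFamily G m f isKRTDF
  open ≤-Reasoning
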